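{- (1) Let $L$ be any logic extending $\mathbf{IL}^-$ (containing its theorems and closed under its rules) which is closed under the rule $\mathbf{R1}$. Then $L$ is closed under the rule $\mathbf{R}^u$: if $L\vdash A\to B$ then $L\vdash \mathbf{I}A\to\mathbf{I}B$. (2) $\mathbf{IL}^-\vdash \Box\bot\leftrightarrow\mathbf{I}\bot$. (3) $\mathbf{IL}^-(\mathbf{J1})\vdash \Box A\to\mathbf{I}A$ for all $A$. (4) $\mathbf{IL}^-(\mathbf{J4})\vdash \mathbf{I}A\land\Diamond\top\to\Diamond A$ for all $A$. (5) $\mathbf{IL}^-(\mathbf{J4}_+)\vdash \Box(A\to B)\to(\mathbf{I}A\to\mathbf{I}B)$ for all $A,B$. (6) $\mathbf{IL}^-(\mathbf{J1},\mathbf{J5})\vdash \Box(A\lor\Diamond A)\to\mathbf{I}A$ for all $A$. (7) $\mathbf{IL}^-(\mathbf{J2},\mathbf{J5})\vdash \Box(A\to\Diamond B)\to(\mathbf{I}A\to\mathbf{I}B)$ for all $A,B$. (8) $\mathbf{IL}^-(\mathbf{J2}_+,\mathbf{J5})\vdash \mathbf{I}(A\lor\Diamond A)\to\mathbf{I}A$ for all $A$.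
   Context: The language $\mathcal{L}(\Box,\rhd)$ consists of propositional variables, $\bot$, $\to$, unary $\Box$ and binary $\rhd$; other connectives are defined as usual, $\Diamond A :\equiv \neg\Box\neg A$, and $\mathbf{I}A :\equiv \top\rhd A$. The logic $\mathbf{IL}^-$ has as axioms all tautologies, $\Box(A\to B)\to(\Box A\to\Box B)$, $\Box(\Box A\to A)\to\Box A$, $\mathbf{J3}$: $(A\rhd C)\land(B\rhd C)\to(A\lor B)\rhd C$, $\mathbf{J6}$: $\Box A\leftrightarrow(\neg A\rhd\bot)$; rules: Modus Ponens, Necessitation, $\mathbf{R1}$: from $A\to B$ infer $(C\rhd A)\to(C\rhd B)$, $\mathbf{R2}$: from $A\to B$ infer $(B\rhd C)\to(A\rhd C)$. Schemata: $\mathbf{J1}$: $\Box(A\to B)\to A\rhd B$; $\mathbf{J2}$: $(A\rhd B)\land(B\rhd C)\to A\rhd C$; $\mathbf{J2}_+$: $(A\rhd(B\lor C))\land(B\rhd C)\to A\rhd C$; $\mathbf{J4}$: $A\rhd B\to(\Diamond A\to\Diamond B)$; $\mathbf{J4}_+$: $\Box(A\to B)\to(C\rhd A\to C\rhd B)$; $\mathbf{J5}$: $\Diamond A\rhd A$. $\mathbf{IL}^-(\Sigma_1,\dots,\Sigma_k)$ is $\mathbf{IL}^-$ with the schemata $\Sigma_i$ added as axioms. -}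

module Defs where

open import Data.Nat using (ℕ)
open import Data.Bool using (Bool; true; false; _∧_; _∨_; not)
open import Relation.Binary.PropositionalEquality using (_≡_)

infixr 5 _⇒_
infix 7 _▷_

data Fm : Set where
  var : ℕ → Fm
  ⊥'  : Fm
  _⇒_ : Fm → Fm → Fm
  □   : Fm → Fm
  _▷_ : Fm → Fm → Fm

¬' : Fm → Fm
¬' A = A ⇒ ⊥'

⊤' : Fm
⊤' = ¬' ⊥'

_∨'_ : Fm → Fm → Fm
A ∨' B = ¬' A ⇒ B

_∧'_ : Fm → Fm → Fm
A ∧' B = ¬' (A ⇒ ¬' B)

_⇔_ : Fm → Fm → Fm
A ⇔ B = (A ⇒ B) ∧' (B ⇒ A)

◇ : Fm → Fm
◇ A = ¬' (□ (¬' A))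

I : Fm → Fm
I A = ⊤' ▷ A

-- Propositional (tautology) semantics: propositional variables, □-formulas
-- and ▷-formulas are treated as atoms, evaluated by an arbitrary valuation.
⟦_⟧ : Fm → (Fm → Bool) → Bool
⟦ var p ⟧ v = v (var p)
⟦ ⊥' ⟧ v = false
⟦ A ⇒ B ⟧ v = not (⟦ A ⟧ v) ∨ ⟦ B ⟧ v
⟦ □ A ⟧ v = v (□ A)
⟦ A ▷ B ⟧ v = v (A ▷ B)

-- A formula is a tautology iff it is a substitution instance of a
-- propositional tautology, i.e. true under every valuation of its atoms.
Tautology : Fm → Set
Tautology A = (v : Fm → Bool) → ⟦ A ⟧ v ≡ true

Schema : Set₁
Schema = Fm → Set

data _⊢_ (Σ : Schema) : Fm → Set where
  taut : ∀ {A} → Tautology A → Σ ⊢ A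
  K    : ∀ {A B} → Σ ⊢ (□ (A ⇒ B) ⇒ (□ A ⇒ □ B))
  L3   : ∀ {A} → Σ ⊢ (□ (□ A ⇒ A) ⇒ □ A)
  J3   : ∀ {A B C} → Σ ⊢ (((A ▷ C) ∧' (B ▷ C)) ⇒ ((A ∨' B) ▷ C))
  J6   : ∀ {A} → Σ ⊢ (□ A ⇔ (¬' A ▷ ⊥'))
  ax   : ∀ {A} → Σ A → Σ ⊢ A
  mp   : ∀ {A B} → Σ ⊢ (A ⇒ B) → Σ ⊢ A → Σ ⊢ B
  nec  : ∀ {A} → Σ ⊢ A → Σ ⊢ □ A
  R1   : ∀ {A B C} → Σ ⊢ (A ⇒ B) → Σ ⊢ ((C ▷ A) ⇒ (C ▷ B))
  R2   : ∀ {A B C} → Σ ⊢ (A ⇒ B) → Σ ⊢ ((B ▷ C) ⇒ (A ▷ C))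

data J1 : Schema where
  j1 : ∀ A B → J1 (□ (A ⇒ B) ⇒ (A ▷ B))

data J2 : Schema where
  j2 : ∀ A B C → J2 (((A ▷ B) ∧' (B ▷ C)) ⇒ (A ▷ C))

data J2₊ : Schema where
  j2₊ : ∀ A B C → J2₊ (((A ▷ (B ∨' C)) ∧' (B ▷ C)) ⇒ (A ▷ C))

data J4 : Schema where
  j4 : ∀ A B → J4 ((A ▷ B) ⇒ (◇ A ⇒ ◇ B))

data J4₊ : Schema where
  j4₊ : ∀ A B C → J4₊ (□ (A ⇒ B) ⇒ ((C ▷ A) ⇒ (C ▷ B)))

data J5 : Schema where
  j5 : ∀ A → J5 (◇ A ▷ A)

data None : Schema where

data _∪_ (Σ₁ Σ₂ : Schema) : Schema where
  inl : ∀ {A} → Σ₁ A → (Σ₁ ∪ Σ₂) A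
  inr : ∀ {A} → Σ₂ A → (Σ₁ ∪ Σ₂) A

record ExtendsIL⁻ (L : Fm → Set) : Set where
  field
    thm : ∀ {A} → None ⊢ A → L A
    closed-mp  : ∀ {A B} → L (A ⇒ B) → L A → L B
    closed-nec : ∀ {A} → L A → L (□ A)
    closed-R2  : ∀ {A B C} → L (A ⇒ B) → L ((B ▷ C) ⇒ (A ▷ C))

ClosedR1 : (Fm → Set) → Set
ClosedR1 L = ∀ {A B C} → L (A ⇒ B) → L ((C ▷ A) ⇒ (C ▷ B))

ClosedRu : (Fm → Set) → Set
ClosedRu L = ∀ {A B} → L (A ⇒ B) → L (I A ⇒ I B)

-- In IL⁻ a boxed implication already composes with ▷ on the left:
-- □(A → C) gives ¬(A → C) ▷ ⊥ by J6, hence ¬(A → C) ▷ B, and together with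
-- C ▷ B, J3 and R2 yield A ▷ B.  With C ▷ B supplied by J5 (C = ◇B) this is
-- item (7), and with C = A ∨ ◇A (A ▷ A from J1, ◇A ▷ A from J5) item (6).
-- The remaining items are instances of the schemata at ⊤ (recall I A = ⊤ ▷ A,
-- and ¬⊥ is ⊤, so (2) is J6 at ⊥), followed by propositional reasoning.
module Submission where

open import Defs
open import Data.Bool using (Bool; true; false; T; _∧_; not; _∨_)
open import Data.Bool.Properties using (T-∧; T-≡)
open import Data.Fin using (Fin; zero; suc)
open import Data.Nat using (ℕ; suc; _+_)
open import Data.Product using (_×_; _,_; proj₁; proj₂)
open import Data.Vec using (Vec; []; _∷_; lookup; map)
open import Data.Vec.Properties using (lookup-map)
open import Function using (_∘_)
open import Function.Bundles using (Equivalence)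
open import Relation.Binary.PropositionalEquality using (_≡_; refl; sym; cong₂; trans)

private
  variable
    n : ℕ

-- Propositional skeletons over n atoms, used to certify tautologies by truth tables.
infixr 5 _⟶_

data Prop (n : ℕ) : Set where
  atom : Fin n → Prop n
  ⊥ₚ   : Prop n
  _⟶_  : Prop n → Prop n → Prop n

-- The defined connectives of Defs, transcribed so that `instantiate` commutes
-- with them definitionally.
¬ₚ : Prop n → Prop n
¬ₚ a = a ⟶ ⊥ₚ

_∨ₚ_ _∧ₚ_ : Prop n → Prop n → Prop n
a ∨ₚ b = ¬ₚ a ⟶ b
a ∧ₚ b = ¬ₚ (a ⟶ ¬ₚ b)

p₀ : Prop (1 + n)
p₀ = atom zero

p₁ : Prop (2 + n)
p₁ = atom (suc zero)

p₂ : Prop (3 + n)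
p₂ = atom (suc (suc zero))

instantiate : Prop n → Vec Fm n → Fm
instantiate (atom i) σ = lookup σ i
instantiate ⊥ₚ       σ = ⊥'
instantiate (a ⟶ b)  σ = instantiate a σ ⇒ instantiate b σ

evaluate : Prop n → Vec Bool n → Bool
evaluate (atom i) ρ = lookup ρ i
evaluate ⊥ₚ       ρ = false
evaluate (a ⟶ b)  ρ = not (evaluate a ρ) ∨ evaluate b ρ

⟦instantiate⟧ : (a : Prop n) (σ : Vec Fm n) (v : Fm → Bool) →
                ⟦ instantiate a σ ⟧ v ≡ evaluate a (map (λ A → ⟦ A ⟧ v) σ)
⟦instantiate⟧ (atom i) σ v = sym (lookup-map i (λ A → ⟦ A ⟧ v) σ)
⟦instantiate⟧ ⊥ₚ       σ v = refl
⟦instantiate⟧ (a ⟶ b)  σ v = cong₂ (λ x y → not x ∨ y) (⟦instantiate⟧ a σ v) (⟦instantiate⟧ b σ v)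

allTrue : ∀ n → (Vec Bool n → Bool) → Bool
allTrue 0       f = f []
allTrue (suc n) f = allTrue n (f ∘ (true ∷_)) ∧ allTrue n (f ∘ (false ∷_))

allTrue-sound : (f : Vec Bool n → Bool) → T (allTrue n f) → ∀ ρ → T (f ρ)
allTrue-sound f holds []          = holds
allTrue-sound f holds (true ∷ ρ)  = allTrue-sound (f ∘ (true ∷_)) (proj₁ (Equivalence.to T-∧ holds)) ρ
allTrue-sound f holds (false ∷ ρ) = allTrue-sound (f ∘ (false ∷_)) (proj₂ (Equivalence.to T-∧ holds)) ρ

instantiate-tautology : (a : Prop n) → T (allTrue n (evaluate a)) →
                        (σ : Vec Fm n) → Tautology (instantiate a σ)
instantiate-tautology a valid σ v =
  trans (⟦instantiate⟧ a σ v) (Equivalence.to T-≡ (allTrue-sound (evaluate a) valid _))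

module _ {Σ : Schema} where

  -- The validity certificate has type ⊤ for a valid skeleton and is found by eta.
  ⊢-tautology : (a : Prop n) (σ : Vec Fm n) {valid : T (allTrue n (evaluate a))} →
                Σ ⊢ instantiate a σ
  ⊢-tautology a σ {valid} = taut (instantiate-tautology a valid σ)

  ⇒-refl : ∀ {X} → Σ ⊢ (X ⇒ X)
  ⇒-refl {X} = ⊢-tautology (p₀ ⟶ p₀) (X ∷ [])

  ⇒-weaken : ∀ {X Y} → Σ ⊢ (Y ⇒ (X ⇒ Y))
  ⇒-weaken {X} {Y} = ⊢-tautology (p₀ ⟶ p₁ ⟶ p₀) (Y ∷ X ∷ [])

  ⇒-const : ∀ {X Y} → Σ ⊢ Y → Σ ⊢ (X ⇒ Y)
  ⇒-const = mp ⇒-weaken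

  ⇒-trans : ∀ {X Y Z} → Σ ⊢ (X ⇒ Y) → Σ ⊢ (Y ⇒ Z) → Σ ⊢ (X ⇒ Z)
  ⇒-trans {X} {Y} {Z} f g =
    mp (mp (⊢-tautology ((p₀ ⟶ p₁) ⟶ (p₁ ⟶ p₂) ⟶ p₀ ⟶ p₂) (X ∷ Y ∷ Z ∷ [])) f) g

  ⇒-∧ : ∀ {H X Y} → Σ ⊢ (H ⇒ X) → Σ ⊢ (H ⇒ Y) → Σ ⊢ (H ⇒ (X ∧' Y))
  ⇒-∧ {H} {X} {Y} f g =
    mp (mp (⊢-tautology ((p₀ ⟶ p₁) ⟶ (p₀ ⟶ p₂) ⟶ p₀ ⟶ p₁ ∧ₚ p₂) (H ∷ X ∷ Y ∷ [])) f) g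

  ∧-fst : ∀ {X Y} → Σ ⊢ ((X ∧' Y) ⇒ X)
  ∧-fst {X} {Y} = ⊢-tautology (p₀ ∧ₚ p₁ ⟶ p₀) (X ∷ Y ∷ [])

  ∧-snd : ∀ {X Y} → Σ ⊢ ((X ∧' Y) ⇒ Y)
  ∧-snd {X} {Y} = ⊢-tautology (p₀ ∧ₚ p₁ ⟶ p₁) (X ∷ Y ∷ [])

  curry : ∀ {X Y Z} → Σ ⊢ ((X ∧' Y) ⇒ Z) → Σ ⊢ (X ⇒ (Y ⇒ Z))
  curry {X} {Y} {Z} = mp (⊢-tautology ((p₀ ∧ₚ p₁ ⟶ p₂) ⟶ p₀ ⟶ p₁ ⟶ p₂) (X ∷ Y ∷ Z ∷ []))

  uncurry : ∀ {X Y Z} → Σ ⊢ (X ⇒ (Y ⇒ Z)) → Σ ⊢ ((X ∧' Y) ⇒ Z)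
  uncurry {X} {Y} {Z} = mp (⊢-tautology ((p₀ ⟶ p₁ ⟶ p₂) ⟶ p₀ ∧ₚ p₁ ⟶ p₂) (X ∷ Y ∷ Z ∷ []))

  ∨-comm : ∀ {X Y} → Σ ⊢ ((X ∨' Y) ⇒ (Y ∨' X))
  ∨-comm {X} {Y} = ⊢-tautology (p₀ ∨ₚ p₁ ⟶ p₁ ∨ₚ p₀) (X ∷ Y ∷ [])

  □-mono : ∀ {A B} → Σ ⊢ (A ⇒ B) → Σ ⊢ (□ A ⇒ □ B)
  □-mono f = mp K (nec f)

  □⇒¬▷⊥ : ∀ {A} → Σ ⊢ (□ A ⇒ (¬' A ▷ ⊥'))
  □⇒¬▷⊥ = mp ∧-fst J6

  ▷-∨ : ∀ {H A B C} → Σ ⊢ (H ⇒ (A ▷ C)) → Σ ⊢ (H ⇒ (B ▷ C)) → Σ ⊢ (H ⇒ ((A ∨' B) ▷ C))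
  ▷-∨ f g = ⇒-trans (⇒-∧ f g) J3

  □⇒-▷-trans : ∀ {A B C} → Σ ⊢ ((□ (A ⇒ C) ∧' (C ▷ B)) ⇒ (A ▷ B))
  □⇒-▷-trans {A} {B} {C} =
    ⇒-trans (▷-∨ (⇒-trans ∧-fst (⇒-trans □⇒¬▷⊥ (R1 ⊥⇒B))) ∧-snd) (R2 A⇒¬[A⇒C]∨C)
    where
    ⊥⇒B : Σ ⊢ (⊥' ⇒ B)
    ⊥⇒B = ⊢-tautology (⊥ₚ ⟶ p₀) (B ∷ [])
    A⇒¬[A⇒C]∨C : Σ ⊢ (A ⇒ (¬' (A ⇒ C) ∨' C))
    A⇒¬[A⇒C]∨C = ⊢-tautology (p₀ ⟶ ¬ₚ (p₀ ⟶ p₁) ∨ₚ p₁) (A ∷ C ∷ [])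

  □⇒-▷ : ∀ {H A B C} → Σ ⊢ (H ⇒ □ (A ⇒ C)) → Σ ⊢ (H ⇒ (C ▷ B)) → Σ ⊢ (H ⇒ (A ▷ B))
  □⇒-▷ f g = ⇒-trans (⇒-∧ f g) □⇒-▷-trans

ClosedR1⇒ClosedRu : (L : Fm → Set) → ExtendsIL⁻ L → ClosedR1 L → ClosedRu L
ClosedR1⇒ClosedRu L _ closed-R1 = closed-R1

□⇒I-J1 : ∀ A → J1 ⊢ (□ A ⇒ I A)
□⇒I-J1 A = ⇒-trans (□-mono ⇒-weaken) (ax (j1 ⊤' A))

I∧◇⊤⇒◇-J4 : ∀ A → J4 ⊢ ((I A ∧' ◇ ⊤') ⇒ ◇ A)
I∧◇⊤⇒◇-J4 A = uncurry (ax (j4 ⊤' A))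

□[∨◇]⇒I-J1J5 : ∀ A → (J1 ∪ J5) ⊢ (□ (A ∨' ◇ A) ⇒ I A)
□[∨◇]⇒I-J1J5 A = □⇒-▷ (□-mono ⇒-weaken) (▷-∨ (⇒-const A▷A) (⇒-const ◇A▷A))
  where
  A▷A : (J1 ∪ J5) ⊢ (A ▷ A)
  A▷A = mp (ax (inl (j1 A A))) (nec ⇒-refl)
  ◇A▷A : (J1 ∪ J5) ⊢ (◇ A ▷ A)
  ◇A▷A = ax (inr (j5 A))

□[⇒◇]⇒I⇒I-J2J5 : ∀ A B → (J2 ∪ J5) ⊢ (□ (A ⇒ ◇ B) ⇒ (I A ⇒ I B))
□[⇒◇]⇒I⇒I-J2J5 A B =
  curry (⇒-trans (⇒-∧ ∧-snd (⇒-trans ∧-fst □[⇒◇]⇒▷)) (ax (inl (j2 ⊤' A B))))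
  where
  □[⇒◇]⇒▷ : (J2 ∪ J5) ⊢ (□ (A ⇒ ◇ B) ⇒ (A ▷ B))
  □[⇒◇]⇒▷ = □⇒-▷ ⇒-refl (⇒-const (ax (inr (j5 B))))

I[∨◇]⇒I-J2₊J5 : ∀ A → (J2₊ ∪ J5) ⊢ (I (A ∨' ◇ A) ⇒ I A)
I[∨◇]⇒I-J2₊J5 A =
  ⇒-trans (⇒-∧ (R1 ∨-comm) (⇒-const (ax (inr (j5 A))))) (ax (inl (j2₊ ⊤' (◇ A) A)))

proposition3p7 : ((L : Fm → Set) → ExtendsIL⁻ L → ClosedR1 L → ClosedRu L)
    × (None ⊢ (□ ⊥' ⇔ I ⊥'))
    × (∀ A → J1 ⊢ (□ A ⇒ I A))
    × (∀ A → J4 ⊢ ((I A ∧' ◇ ⊤') ⇒ ◇ A))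
    × (∀ A B → J4₊ ⊢ (□ (A ⇒ B) ⇒ (I A ⇒ I B)))
    × (∀ A → (J1 ∪ J5) ⊢ (□ (A ∨' ◇ A) ⇒ I A))
    × (∀ A B → (J2 ∪ J5) ⊢ (□ (A ⇒ ◇ B) ⇒ (I A ⇒ I B)))
    × (∀ A → (J2₊ ∪ J5) ⊢ (I (A ∨' ◇ A) ⇒ I A))
proposition3p7 =
    ClosedR1⇒ClosedRu
  , J6
  , □⇒I-J1
  , I∧◇⊤⇒◇-J4
  , (λ A B → ax (j4₊ A B ⊤'))
  , □[∨◇]⇒I-J1J5
  , □[⇒◇]⇒I⇒I-J2J5
  , I[∨◇]⇒I-J2₊J5
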